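{- Let $\mathcal{A}=(V,\Sigma,\delta)$ be a parameterized arena complete for enabled actions. For every $(v,a)\in V\times\Sigma$ and every two sets $S,S'$ of pairs $(u,K)$ with $u\in V$, $K\subseteq\mathbb{N}_{\geq1}$, such that $S\lesssim S'$, we have $\mathrm{KPredAlt}_{v,a}(S)\lesssim\mathrm{KPredAlt}_{v,a}(S')$ (i.e., for every $K\in\mathrm{KPredAlt}_{v,a}(S)$ there is $K'\in\mathrm{KPredAlt}_{v,a}(S')$ with $K\subseteq K'$) and $\mathrm{PredAlt}(S)\lesssim\mathrm{PredAlt}(S')$.
   Context: $\mathbb{N}_{\geq 1}$ denotes the positive integers. A parameterized arena is $\mathcal{A}=(V,\Sigma,\delta)$ with $V$ finite, $\Sigma$ finite, $\delta:V\times\Sigma\times\mathbb{N}_{\geq1}\to 2^V$; $\mathrm{En}(v)$ is the set of $a$ with $\delta(v,a,k)\neq\emptyset$ for some $k$; complete for enabled actions means $a\in\mathrm{En}(v)$ implies $\delta(v,a,k)\neq\emptyset$ for all $k$. Let $\nabla(v,a,v')=\{k\in\mathbb{N}_{\geq1}\mid v'\in\delta(v,a,k)\}$ and, for $V'\subseteq V$, $\nabla(v,a,V')=\bigcap_{v'\in V'}\nabla(v,a,v')\setminus\bigcup_{v'\notin V'}\nabla(v,a,v')$ (empty intersection is $\mathbb{N}_{\geq1}$). Order: $(u,K)\preceq(u',K')$ iff $u=u'$ and $K\subseteq K'$. For two sets $L,L'$ of elements of a partially ordered set, $L\lesssim L'$ means every $x\in L$ has some $x'\in L'$ with $x\preceq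 x'$ (for families of subsets of $\mathbb{N}_{\geq1}$ the order is inclusion). Operators: $\mathrm{KPredAlt}_{v,a}(S)=\{\bigcup_{V'\subseteq V}\big(\nabla(v,a,V')\cap\bigcap_{v'\in V'}K_{v'}\big)\mid$ for each $v'\in V$, $K_{v'}$ is such that $(v',K_{v'})\in S\}$, and $\mathrm{PredAlt}(S)=\bigcup_{v\in V}\bigcup_{a\in\mathrm{En}(v)}\{(v,K)\mid K\in\mathrm{KPredAlt}_{v,a}(S)\}$. -}

module Defs where

open import Level using (0ℓ)
open import Data.Nat using (ℕ; _≤_)
open import Data.Fin using (Fin)
open import Data.Fin.Subset using (Subset; _∈_; _∉_)
open import Data.Product using (Σ; Σ-syntax; ∃; ∃-syntax; _×_)
open import Relation.Nullary using (¬_)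
open import Relation.Unary using (Pred) renaming (_⊆_ to _⊆ₚ_)

ℕ⁺ : Set
ℕ⁺ = Σ[ k ∈ ℕ ] 1 ≤ k

NSet : Set₁
NSet = Pred ℕ⁺ 0ℓ

-- Parameterized arena with V = Fin n, Σ = Fin m,
-- δ : V × Σ × ℕ_{≥1} → 2^V
record Arena (n m : ℕ) : Set where
  field
    δ : Fin n → Fin m → ℕ⁺ → Subset n

module _ {n m : ℕ} (𝒜 : Arena n m) where
  open Arena 𝒜

  NonEmptyδ : Fin n → Fin m → ℕ⁺ → Set
  NonEmptyδ v a k = ∃[ v' ] v' ∈ δ v a k

  En : Fin n → Fin m → Set
  En v a = ∃[ k ] NonEmptyδ v a k

  CompleteForEnabled : Set
  CompleteForEnabled = ∀ v a → En v a → ∀ k → NonEmptyδ v a k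

  ∇ : Fin n → Fin m → Fin n → NSet
  ∇ v a v' k = v' ∈ δ v a k

  ∇ₛ : Fin n → Fin m → Subset n → NSet
  ∇ₛ v a V' k = (∀ v' → v' ∈ V' → ∇ v a v' k) × (∀ v' → v' ∉ V' → ¬ ∇ v a v' k)

  PairSet : Set₂
  PairSet = Fin n → NSet → Set₁

  KComb : Fin n → Fin m → (Fin n → NSet) → NSet
  KComb v a Kf k = ∃[ V' ] (∇ₛ v a V' k × (∀ v' → v' ∈ V' → Kf v' k))

  KPredAlt : Fin n → Fin m → PairSet → NSet → Set₁
  KPredAlt v a S K =
    Σ[ Kf ∈ (Fin n → NSet) ] ((∀ v' → S v' (Kf v')) ×
      (K ⊆ₚ KComb v a Kf) × (KComb v a Kf ⊆ₚ K))

  PredAlt : PairSet → PairSet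
  PredAlt S v K = Σ[ a ∈ Fin m ] (En v a × KPredAlt v a S K)

_≲ₖ_ : (NSet → Set₁) → (NSet → Set₁) → Set₁
L ≲ₖ L' = ∀ K → L K → Σ[ K' ∈ NSet ] (L' K' × K ⊆ₚ K')

-- S ≲ S' for sets of pairs (order: (u,K) ⪯ (u',K') iff u = u' and K ⊆ K')
_≲ₚ_ : {n : ℕ} → (Fin n → NSet → Set₁) → (Fin n → NSet → Set₁) → Set₁
S ≲ₚ S' = ∀ u K → S u K → Σ[ K' ∈ NSet ] (S' u K' × K ⊆ₚ K')

module Submission where

open import Defs
open import Data.Nat using (ℕ)
open import Data.Fin using (Fin)
open import Data.Product using (_×_; _,_; proj₁; proj₂)
open import Relation.Unary using (_⊆_)

-- Each K_{v'} is enlarged to a dominating K'_{v'} from S'; the union of the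
-- sets ∇(v,a,V') ∩ ⋂ K_{v'} only grows, and the enlarged family is admissible for S'.

module _ {n m : ℕ} (𝒜 : Arena n m) where

  KComb-mono : ∀ {v a} {Kf Kf′ : Fin n → NSet} → (∀ v′ → Kf v′ ⊆ Kf′ v′) →
    KComb 𝒜 v a Kf ⊆ KComb 𝒜 v a Kf′
  KComb-mono Kf⊆Kf′ (V′ , k∈∇ , k∈Kf) = V′ , k∈∇ , λ v′ v′∈V′ → Kf⊆Kf′ v′ (k∈Kf v′ v′∈V′)

  KPredAlt-mono : ∀ {v a} {S S′ : PairSet 𝒜} → S ≲ₚ S′ →
    KPredAlt 𝒜 v a S ≲ₖ KPredAlt 𝒜 v a S′
  KPredAlt-mono {v} {a} {S′ = S′} S≲S′ K (Kf , Kf∈S , K⊆ , ⊆K) =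
    KComb 𝒜 v a Kf′ , (Kf′ , Kf′∈S′ , (λ k → k) , (λ k → k)) , λ k∈K → KComb-mono Kf⊆Kf′ (K⊆ k∈K)
    where
    Kf′ : Fin n → NSet
    Kf′ v′ = proj₁ (S≲S′ v′ (Kf v′) (Kf∈S v′))
    Kf′∈S′ : ∀ v′ → S′ v′ (Kf′ v′)
    Kf′∈S′ v′ = proj₁ (proj₂ (S≲S′ v′ (Kf v′) (Kf∈S v′)))
    Kf⊆Kf′ : ∀ v′ → Kf v′ ⊆ Kf′ v′
    Kf⊆Kf′ v′ = proj₂ (proj₂ (S≲S′ v′ (Kf v′) (Kf∈S v′)))

  PredAlt-mono : {S S′ : PairSet 𝒜} → S ≲ₚ S′ → PredAlt 𝒜 S ≲ₚ PredAlt 𝒜 S′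
  PredAlt-mono S≲S′ u K (a , enabled , K∈) =
    let K′ , K′∈ , K⊆K′ = KPredAlt-mono S≲S′ K K∈ in K′ , (a , enabled , K′∈) , K⊆K′

lemma18 : {n m : ℕ} (𝒜 : Arena n m) → CompleteForEnabled 𝒜 →
    (v : Fin n) (a : Fin m) (S S' : PairSet 𝒜) → S ≲ₚ S' →
    (KPredAlt 𝒜 v a S ≲ₖ KPredAlt 𝒜 v a S') × (PredAlt 𝒜 S ≲ₚ PredAlt 𝒜 S')
lemma18 𝒜 _ v a S S' S≲S' = KPredAlt-mono 𝒜 S≲S' , PredAlt-mono 𝒜 S≲S'
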